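{- Over $\mathrm{IKP}$, the following are equivalent: (1) $\mathrm{PlUb}$ holds and the plump operator $(-)^{\mathrm{pl}}:\mathrm{Ord}\to\mathrm{PlOrd}$ is injective; (2) the axiom of restricted excluded middle $\forall x\,\forall y\,(x\in y\lor\neg x\in y)$.
   Context: $\mathrm{IKP}$ is intuitionistic Kripke–Platek set theory with strong infinity: over intuitionistic logic, the axioms of extensionality, empty set, pairing, union, $\Delta_0$-separation, $\Delta_0$-collection, the set induction scheme, and existence of $\omega$. $\mathrm{Ord}$ is the class of transitive sets all of whose elements are transitive. For sets $\alpha,\gamma$ let $\mathrm{relpl}_\alpha(\gamma)$ abbreviate $\forall\delta\in\gamma\,\forall\varepsilon\in\alpha\,(\varepsilon\subseteq\delta\to\varepsilon\in\gamma)$. $\mathrm{PlOrd}$ is the class of $\alpha\in\mathrm{Ord}$ such that for all $\beta\in\alpha$ and all $\gamma\subseteq\beta$, if $\mathrm{relpl}_\alpha(\gamma)$ then $\gamma\in\alpha$ and for every $\delta\in\alpha$, $\beta\in\delta$ implies $\gamma\in\delta$. $\mathrm{PlUb}$ is the axiom $\forall\alpha\in\mathrm{PlOrd}\,\exists\beta\in\mathrm{PlOrd}\,\alpha\in\beta$; under $\mathrm{PlUb}$, for each $\alpha\in\mathrm{PlOrd}$ the plump successor $\alpha^{\mathrm{pl}+}=\{\beta\subseteq\alpha:\mathrm{relpl}_\alpha(\beta)\}$ is a set. Assuming $\mathrm{PlUb}$, the plump operator is defined by recursion as $\alpha^{\mathrm{pl}}=\bigcup_{\beta\in\alpha}(\beta^{\mathrm{pl}})^{\mathrm{pl}+}$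 for $\alpha\in\mathrm{Ord}$; it takes values in $\mathrm{PlOrd}$. -}

module Defs where

-- Variables are de Bruijn indices: in  Fm n  there are n free variables
-- (Fin n); under a binder the bound variable is  zero  and outer ones are
-- shifted by  suc.

open import Data.Nat using (ℕ; zero; suc; _+_)
open import Data.Fin using (Fin; zero; suc; _↑ʳ_)
open import Data.List using (List; []; _∷_; map)
open import Data.List.Membership.Propositional using (_∈_)

infix  7 _ε_ _≐_
infixr 6 _∧'_
infixr 5 _∨'_
infixr 4 _⇒'_
infix  3 _⇔'_

data Fm (n : ℕ) : Set where
  _ε_ _≐_          : Fin n → Fin n → Fm n
  ⊥'               : Fm n
  _∧'_ _∨'_ _⇒'_   : Fm n → Fm n → Fm n
  All Ex           : Fm (suc n) → Fm n

¬'_ : ∀ {n} → Fm n → Fm n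
¬' φ = φ ⇒' ⊥'

_⇔'_ : ∀ {n} → Fm n → Fm n → Fm n
φ ⇔' ψ = (φ ⇒' ψ) ∧' (ψ ⇒' φ)

All∈ : ∀ {n} → Fin n → Fm (suc n) → Fm n
All∈ x φ = All ((zero ε suc x) ⇒' φ)

Ex∈ : ∀ {n} → Fin n → Fm (suc n) → Fm n
Ex∈ x φ = Ex ((zero ε suc x) ∧' φ)

ext : ∀ {n m} → (Fin n → Fin m) → Fin (suc n) → Fin (suc m)
ext ρ zero    = zero
ext ρ (suc i) = suc (ρ i)

ren : ∀ {n m} → (Fin n → Fin m) → Fm n → Fm m
ren ρ (x ε y)  = ρ x ε ρ y
ren ρ (x ≐ y)  = ρ x ≐ ρ y
ren ρ ⊥'       = ⊥'
ren ρ (φ ∧' ψ) = ren ρ φ ∧' ren ρ ψ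
ren ρ (φ ∨' ψ) = ren ρ φ ∨' ren ρ ψ
ren ρ (φ ⇒' ψ) = ren ρ φ ⇒' ren ρ ψ
ren ρ (All φ)  = All (ren (ext ρ) φ)
ren ρ (Ex φ)   = Ex (ren (ext ρ) φ)

wk : ∀ {n} → Fm n → Fm (suc n)
wk = ren suc

sub0 : ∀ {n} → Fin n → Fin (suc n) → Fin n
sub0 x zero    = x
sub0 x (suc i) = i

_[_] : ∀ {n} → Fm (suc n) → Fin n → Fm n
φ [ x ] = ren (sub0 x) φ

data Δ₀ {n : ℕ} : Fm n → Set where
  mem  : (x y : Fin n) → Δ₀ (x ε y)
  eq   : (x y : Fin n) → Δ₀ (x ≐ y)
  bot  : Δ₀ ⊥'
  and  : ∀ {φ ψ} → Δ₀ φ → Δ₀ ψ → Δ₀ (φ ∧' ψ)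
  or   : ∀ {φ ψ} → Δ₀ φ → Δ₀ ψ → Δ₀ (φ ∨' ψ)
  imp  : ∀ {φ ψ} → Δ₀ φ → Δ₀ ψ → Δ₀ (φ ⇒' ψ)
  ball : (x : Fin n) {φ : Fm (suc n)} → Δ₀ φ → Δ₀ (All∈ x φ)
  bex  : (x : Fin n) {φ : Fm (suc n)} → Δ₀ φ → Δ₀ (Ex∈ x φ)

v0 : ∀ {n} → Fin (suc n)
v0 = zero
v1 : ∀ {n} → Fin (suc (suc n))
v1 = suc zero
v2 : ∀ {n} → Fin (suc (suc (suc n)))
v2 = suc v1
v3 : ∀ {n} → Fin (suc (suc (suc (suc n))))
v3 = suc v2

-- parameter shifts for axiom schemes: variables below 1 (resp. 2) are kept,
-- parameters are moved past k further bound variables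
lift1 : ∀ {n} (k : ℕ) → Fin (suc n) → Fin (suc (k + n))
lift1 k zero    = zero
lift1 k (suc i) = (suc k) ↑ʳ i

lift2 : ∀ {n} (k : ℕ) → Fin (suc (suc n)) → Fin (suc (suc (k + n)))
lift2 k zero          = zero
lift2 k (suc zero)    = suc zero
lift2 k (suc (suc i)) = (suc (suc k)) ↑ʳ i

Sub : ∀ {n} → Fin n → Fin n → Fm n
Sub x y = All ((v0 ε suc x) ⇒' (v0 ε suc y))

Trans : ∀ {n} → Fin n → Fm n
Trans x = All∈ x (Sub v0 (suc x))

Ord : ∀ {n} → Fin n → Fm n
Ord x = Trans x ∧' All∈ x (Trans v0)

-- Ind(x) : ∅ ∈ x ∧ ∀y∈x (y ∪ {y} ∈ x)
Ind : ∀ {n} → Fin n → Fm n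
Ind x = Ex∈ x (All (¬' (v0 ε v1)))
     ∧' All∈ x (Ex∈ (suc x) (All ((v0 ε v1) ⇔' ((v0 ε v2) ∨' (v0 ≐ v2)))))

-- The axioms of IKP (schemes with parameters = free variables)

data Axiom {n : ℕ} : Fm n → Set where
  extensionality : Axiom (All (All (All ((v0 ε v2) ⇔' (v0 ε v1)) ⇒' (v1 ≐ v0))))
  emptySet       : Axiom (Ex (All (¬' (v0 ε v1))))
  pairing        : Axiom (All (All (Ex ((v2 ε v0) ∧' (v1 ε v0)))))
  union          : Axiom (All (Ex (All∈ v1 (All∈ v0 (v0 ε v2)))))
  -- ∀a ∃b ∀x (x ∈ b ↔ x ∈ a ∧ φ(x, params)),  φ Δ₀
  Δ₀-separation  : (φ : Fm (suc n)) → Δ₀ φ →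
    Axiom (All (Ex (All ((v0 ε v1) ⇔' ((v0 ε v2) ∧' ren (lift1 2) φ)))))
  -- ∀a (∀x∈a ∃y φ(x,y) → ∃b ∀x∈a ∃y∈b φ(x,y)),  φ Δ₀ (y = var 0, x = var 1)
  Δ₀-collection  : (φ : Fm (suc (suc n))) → Δ₀ φ →
    Axiom (All (All∈ v0 (Ex (ren (lift2 1) φ))
                 ⇒' Ex (All∈ v1 (Ex∈ v1 (ren (lift2 2) φ)))))
  -- ∀a (∀x∈a φ(x) → φ(a)) → ∀a φ(a),  φ arbitrary
  setInduction   : (φ : Fm (suc n)) →
    Axiom (All (All∈ v0 (ren (lift1 1) φ) ⇒' φ) ⇒' All φ)
  -- strong infinity: ω exists as the least inductive set
  strongInfinity : Axiom (Ex (Ind v0 ∧' All (Ind v0 ⇒' Sub v1 v0)))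

infix 2 _⊢_

data _⊢_ : {n : ℕ} → List (Fm n) → Fm n → Set where
  ax     : ∀ {n} {Γ : List (Fm n)} {φ} → Axiom φ → Γ ⊢ φ
  hyp    : ∀ {n} {Γ : List (Fm n)} {φ} → φ ∈ Γ → Γ ⊢ φ
  ⊥E     : ∀ {n} {Γ : List (Fm n)} {φ} → Γ ⊢ ⊥' → Γ ⊢ φ
  ∧I     : ∀ {n} {Γ : List (Fm n)} {φ ψ} → Γ ⊢ φ → Γ ⊢ ψ → Γ ⊢ φ ∧' ψ
  ∧E₁    : ∀ {n} {Γ : List (Fm n)} {φ ψ} → Γ ⊢ φ ∧' ψ → Γ ⊢ φ
  ∧E₂    : ∀ {n} {Γ : List (Fm n)} {φ ψ} → Γ ⊢ φ ∧' ψ → Γ ⊢ ψ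
  ∨I₁    : ∀ {n} {Γ : List (Fm n)} {φ ψ} → Γ ⊢ φ → Γ ⊢ φ ∨' ψ
  ∨I₂    : ∀ {n} {Γ : List (Fm n)} {φ ψ} → Γ ⊢ ψ → Γ ⊢ φ ∨' ψ
  ∨E     : ∀ {n} {Γ : List (Fm n)} {φ ψ χ} →
           Γ ⊢ φ ∨' ψ → φ ∷ Γ ⊢ χ → ψ ∷ Γ ⊢ χ → Γ ⊢ χ
  ⇒I     : ∀ {n} {Γ : List (Fm n)} {φ ψ} → φ ∷ Γ ⊢ ψ → Γ ⊢ φ ⇒' ψ
  ⇒E     : ∀ {n} {Γ : List (Fm n)} {φ ψ} → Γ ⊢ φ ⇒' ψ → Γ ⊢ φ → Γ ⊢ ψ
  ∀I     : ∀ {n} {Γ : List (Fm n)} {φ} → map wk Γ ⊢ φ → Γ ⊢ All φ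
  ∀E     : ∀ {n} {Γ : List (Fm n)} {φ} → Γ ⊢ All φ → (x : Fin n) → Γ ⊢ φ [ x ]
  ∃I     : ∀ {n} {Γ : List (Fm n)} {φ} → (x : Fin n) → Γ ⊢ φ [ x ] → Γ ⊢ Ex φ
  ∃E     : ∀ {n} {Γ : List (Fm n)} {φ ψ} →
           Γ ⊢ Ex φ → φ ∷ map wk Γ ⊢ wk ψ → Γ ⊢ ψ
  ≐refl  : ∀ {n} {Γ : List (Fm n)} (x : Fin n) → Γ ⊢ x ≐ x
  ≐subst : ∀ {n} {Γ : List (Fm n)} (φ : Fm (suc n)) {x y : Fin n} →
           Γ ⊢ x ≐ y → Γ ⊢ φ [ x ] → Γ ⊢ φ [ y ]

IKP⊢_ : Fm 0 → Set
IKP⊢ φ = [] ⊢ φ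

-- relpl_a(g) : ∀δ∈g ∀ε∈a (ε ⊆ δ → ε ∈ g)
relpl : ∀ {n} → Fin n → Fin n → Fm n
relpl a g = All∈ g (All∈ (suc a) (Sub v0 v1 ⇒' (v0 ε suc (suc g))))

PlOrd : ∀ {n} → Fin n → Fm n
PlOrd a = Ord a ∧'
  All∈ a (All (Sub v0 v1 ⇒' relpl (suc (suc a)) v0 ⇒'
     ((v0 ε suc (suc a)) ∧'
      All∈ (suc (suc a)) ((v2 ε v0) ⇒' (v1 ε v0)))))

PlUb : ∀ {n} → Fm n
PlUb = All (PlOrd v0 ⇒' Ex (PlOrd v0 ∧' (v1 ε v0)))

-- z ∈ d^{pl+}  (i.e. z ⊆ d ∧ relpl_d(z))
InPlSucc : ∀ {n} → Fin n → Fin n → Fm n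
InPlSucc z d = Sub z d ∧' relpl d z

-- Kuratowski pairs: z = {a}, z = {a,b}, p = ⟨a,b⟩ = {{a},{a,b}}
Sing : ∀ {n} → Fin n → Fin n → Fm n
Sing z a = (a ε z) ∧' All∈ z (v0 ≐ suc a)

Dbl : ∀ {n} → Fin n → Fin n → Fin n → Fm n
Dbl z a b = (a ε z) ∧' (b ε z) ∧' All∈ z ((v0 ≐ suc a) ∨' (v0 ≐ suc b))

Pair : ∀ {n} → Fin n → Fin n → Fin n → Fm n
Pair p a b = Ex∈ p (Sing v0 (suc a)) ∧' Ex∈ p (Dbl v0 (suc a) (suc b))
          ∧' All∈ p (Sing v0 (suc a) ∨' Dbl v0 (suc a) (suc b))

PairIn : ∀ {n} → Fin n → Fin n → Fin n → Fm n
PairIn f a b = Ex∈ f (Pair v0 (suc a) (suc b))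

-- f is an attempt at the recursion defining (-)^pl:
--  every element of f is a pair ⟨a,b⟩ with
--  (i)  ∀c∈a ∃d ⟨c,d⟩ ∈ f   (domain closed under ∈)
--  (ii) b = ⋃_{c∈a} (f(c))^{pl+}, i.e.
--       ∀z (z ∈ b ↔ ∃c∈a ∃d (⟨c,d⟩ ∈ f ∧ z ∈ d^{pl+}))
PlAttempt : ∀ {n} → Fin n → Fm n
PlAttempt f =
  All∈ f (All (All (Pair v2 v1 v0 ⇒'
    (All∈ v1 (Ex (PairIn (5 ↑ʳ f) v1 v0)) ∧'
     All ((v0 ε v1) ⇔'
          Ex∈ v2 (Ex (PairIn (6 ↑ʳ f) v1 v0 ∧' InPlSucc v2 v0)))))))

-- y = a^pl  (Σ-definition of the recursively defined plump operator)
PlG : ∀ {n} → Fin n → Fin n → Fm n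
PlG a y = Ex (PlAttempt v0 ∧' PairIn v0 (suc a) (suc y))

Cond1 : Fm 0
Cond1 = PlUb ∧'
  All (All (All ((Ord v2 ∧' Ord v1 ∧' PlG v2 v0 ∧' PlG v1 v0) ⇒' (v2 ≐ v1))))

REM : Fm 0
REM = All (All ((v1 ε v0) ∨' ¬' (v1 ε v0)))

-- Under REM, ∈ is trichotomous on ordinals, and a subset g ⊆ c of an ordinal with relpl_c(g) is either
-- an element of c or c itself.  Hence every ordinal is plump, the successor a ∪ {a} of a plump a witnesses
-- PlUb, and by ∈-induction a^pl = ⋃_{c ∈ a} c^pl+ = a for every ordinal a, so (-)^pl is injective.
--
-- Conversely, given x and y let A = {∅ | x ∈ y} ⊆ 1 and α = 2 ∪ {A}.  Both α and 2 are ordinals, and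
-- (-)^pl is the identity on 0, 1 and A, so α^pl = 0^pl+ ∪ 1^pl+ ∪ A^pl+ = 𝒫(1) = 2^pl (PlUb is needed for
-- 𝒫(1) to exist).  Injectivity gives α = 2, so A ∈ 2 = {0, 1}: A = 1 means x ∈ y and A = 0 means x ∉ y.

module Submission where

open import Defs
open import Data.Nat using (ℕ; zero; suc; _+_)
open import Data.Fin using (Fin; zero; suc; _↑ʳ_)
open import Data.List using (List; []; _∷_; map)
open import Data.List.Membership.Propositional.Properties using (∈-map⁺)
open import Data.List.Relation.Binary.Subset.Propositional using (_⊆_)
open import Data.List.Relation.Binary.Subset.Propositional.Properties using (map⁺; ∷⁺ʳ; xs⊆x∷xs)
open import Data.List.Relation.Unary.Any using (here; there)
open import Function using (_∘_)
open import Relation.Binary.PropositionalEquality using (_≡_; refl; sym; trans; cong; cong₂; subst; subst₂)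

private variable
  n : ℕ
  Γ Δ : List (Fm n)
  φ ψ χ θ₀ θ₁ θ₂ θ₃ θ₄ θ₅ θ₆ θ₇ θ₈ θ₉ θ₁₀ θ₁₁ : Fm n

weaken : Γ ⊆ Δ → Γ ⊢ φ → Δ ⊢ φ
weaken s (ax α)          = ax α
weaken s (hyp i)         = hyp (s i)
weaken s (⊥E d)          = ⊥E (weaken s d)
weaken s (∧I d e)        = ∧I (weaken s d) (weaken s e)
weaken s (∧E₁ d)         = ∧E₁ (weaken s d)
weaken s (∧E₂ d)         = ∧E₂ (weaken s d)
weaken s (∨I₁ d)         = ∨I₁ (weaken s d)
weaken s (∨I₂ d)         = ∨I₂ (weaken s d)
weaken s (∨E d e f)      = ∨E (weaken s d) (weaken (∷⁺ʳ _ s) e) (weaken (∷⁺ʳ _ s) f)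
weaken s (⇒I d)          = ⇒I (weaken (∷⁺ʳ _ s) d)
weaken s (⇒E d e)        = ⇒E (weaken s d) (weaken s e)
weaken s (∀I d)          = ∀I (weaken (map⁺ wk s) d)
weaken s (∀E d x)        = ∀E (weaken s d) x
weaken s (∃I x d)        = ∃I x (weaken s d)
weaken s (∃E d e)        = ∃E (weaken s d) (weaken (∷⁺ʳ _ (map⁺ wk s)) e)
weaken s (≐refl x)       = ≐refl x
weaken s (≐subst φ d e)  = ≐subst φ (weaken s d) (weaken s e)

cast : φ ≡ ψ → Γ ⊢ φ → Γ ⊢ ψ
cast {Γ = Γ} = subst (Γ ⊢_)

up : Γ ⊢ φ → (ψ ∷ Γ) ⊢ φ
up = weaken there

h0 : (φ ∷ Γ) ⊢ φ
h0 = hyp (here refl)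

h1 : (θ₀ ∷ φ ∷ Γ) ⊢ φ
h1 = up h0

h2 : (θ₀ ∷ θ₁ ∷ φ ∷ Γ) ⊢ φ
h2 = up h1

h3 : (θ₀ ∷ θ₁ ∷ θ₂ ∷ φ ∷ Γ) ⊢ φ
h3 = up h2

h4 : (θ₀ ∷ θ₁ ∷ θ₂ ∷ θ₃ ∷ φ ∷ Γ) ⊢ φ
h4 = up h3

h5 : (θ₀ ∷ θ₁ ∷ θ₂ ∷ θ₃ ∷ θ₄ ∷ φ ∷ Γ) ⊢ φ
h5 = up h4

h6 : (θ₀ ∷ θ₁ ∷ θ₂ ∷ θ₃ ∷ θ₄ ∷ θ₅ ∷ φ ∷ Γ) ⊢ φ
h6 = up h5

h7 : (θ₀ ∷ θ₁ ∷ θ₂ ∷ θ₃ ∷ θ₄ ∷ θ₅ ∷ θ₆ ∷ φ ∷ Γ) ⊢ φ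
h7 = up h6

h8 : (θ₀ ∷ θ₁ ∷ θ₂ ∷ θ₃ ∷ θ₄ ∷ θ₅ ∷ θ₆ ∷ θ₇ ∷ φ ∷ Γ) ⊢ φ
h8 = up h7

h9 : (θ₀ ∷ θ₁ ∷ θ₂ ∷ θ₃ ∷ θ₄ ∷ θ₅ ∷ θ₆ ∷ θ₇ ∷ θ₈ ∷ φ ∷ Γ) ⊢ φ
h9 = up h8

h10 : (θ₀ ∷ θ₁ ∷ θ₂ ∷ θ₃ ∷ θ₄ ∷ θ₅ ∷ θ₆ ∷ θ₇ ∷ θ₈ ∷ θ₉ ∷ φ ∷ Γ) ⊢ φ
h10 = up h9

h11 : (θ₀ ∷ θ₁ ∷ θ₂ ∷ θ₃ ∷ θ₄ ∷ θ₅ ∷ θ₆ ∷ θ₇ ∷ θ₈ ∷ θ₉ ∷ θ₁₀ ∷ φ ∷ Γ) ⊢ φ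
h11 = up h10

h12 : (θ₀ ∷ θ₁ ∷ θ₂ ∷ θ₃ ∷ θ₄ ∷ θ₅ ∷ θ₆ ∷ θ₇ ∷ θ₈ ∷ θ₉ ∷ θ₁₀ ∷ θ₁₁ ∷ φ ∷ Γ) ⊢ φ
h12 = up h11

ext-∘ : ∀ {k m l} {ρ : Fin m → Fin l} {σ : Fin k → Fin m} {τ : Fin k → Fin l} →
        (∀ i → ρ (σ i) ≡ τ i) → ∀ i → ext ρ (ext σ i) ≡ ext τ i
ext-∘ e zero    = refl
ext-∘ e (suc i) = cong suc (e i)

ren-∘ : ∀ {k m l} {ρ : Fin m → Fin l} {σ : Fin k → Fin m} {τ : Fin k → Fin l} →
        (∀ i → ρ (σ i) ≡ τ i) → (φ : Fm k) → ren ρ (ren σ φ) ≡ ren τ φ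
ren-∘ e (x ε y)  = cong₂ _ε_ (e x) (e y)
ren-∘ e (x ≐ y)  = cong₂ _≐_ (e x) (e y)
ren-∘ e ⊥'       = refl
ren-∘ e (φ ∧' ψ) = cong₂ _∧'_ (ren-∘ e φ) (ren-∘ e ψ)
ren-∘ e (φ ∨' ψ) = cong₂ _∨'_ (ren-∘ e φ) (ren-∘ e ψ)
ren-∘ e (φ ⇒' ψ) = cong₂ _⇒'_ (ren-∘ e φ) (ren-∘ e ψ)
ren-∘ e (All φ)  = cong All (ren-∘ (ext-∘ e) φ)
ren-∘ e (Ex φ)   = cong Ex (ren-∘ (ext-∘ e) φ)

ren-comm : ∀ {k m m′ l} (ρ : Fin m → Fin l) (σ : Fin k → Fin m) (ρ′ : Fin m′ → Fin l) (σ′ : Fin k → Fin m′) →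
           (∀ i → ρ (σ i) ≡ ρ′ (σ′ i)) → ∀ φ → ren ρ (ren σ φ) ≡ ren ρ′ (ren σ′ φ)
ren-comm ρ σ ρ′ σ′ e φ = trans (ren-∘ (λ _ → refl) φ) (sym (ren-∘ {ρ = ρ′} {σ′} {ρ ∘ σ} (λ i → sym (e i)) φ))

ren-[] : ∀ {k m} (ρ : Fin k → Fin m) (x : Fin k) (φ : Fm (suc k)) → ren ρ (φ [ x ]) ≡ (ren (ext ρ) φ) [ ρ x ]
ren-[] ρ x = ren-comm ρ (sub0 x) (sub0 (ρ x)) (ext ρ) (λ { zero → refl ; (suc i) → refl })

map-wk-ren : ∀ {k m} (ρ : Fin k → Fin m) (Γ : List (Fm k)) → map (ren (ext ρ)) (map wk Γ) ≡ map wk (map (ren ρ) Γ)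
map-wk-ren ρ []      = refl
map-wk-ren ρ (φ ∷ Γ) = cong₂ _∷_ (ren-comm (ext ρ) suc suc ρ (λ _ → refl) φ) (map-wk-ren ρ Γ)

Δ₀-ren : ∀ {k m} (ρ : Fin k → Fin m) {φ : Fm k} → Δ₀ φ → Δ₀ (ren ρ φ)
Δ₀-ren ρ (mem x y)  = mem (ρ x) (ρ y)
Δ₀-ren ρ (eq x y)   = eq (ρ x) (ρ y)
Δ₀-ren ρ bot        = bot
Δ₀-ren ρ (and δ δ′) = and (Δ₀-ren ρ δ) (Δ₀-ren ρ δ′)
Δ₀-ren ρ (or δ δ′)  = or (Δ₀-ren ρ δ) (Δ₀-ren ρ δ′)
Δ₀-ren ρ (imp δ δ′) = imp (Δ₀-ren ρ δ) (Δ₀-ren ρ δ′)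
Δ₀-ren ρ (ball x δ) = ball (ρ x) (Δ₀-ren (ext ρ) δ)
Δ₀-ren ρ (bex x δ)  = bex (ρ x) (Δ₀-ren (ext ρ) δ)

Axiom-ren : ∀ {k m} (ρ : Fin k → Fin m) {φ : Fm k} → Axiom φ → Axiom (ren ρ φ)
Axiom-ren ρ extensionality = extensionality
Axiom-ren ρ emptySet       = emptySet
Axiom-ren ρ pairing        = pairing
Axiom-ren ρ union          = union
Axiom-ren ρ (Δ₀-separation φ δ) =
  subst Axiom (cong (λ ψ → All (Ex (All ((v0 ε v1) ⇔' ((v0 ε v2) ∧' ψ)))))
    (ren-comm (lift1 2) (ext ρ) (ext (ext (ext ρ))) (lift1 2) (λ { zero → refl ; (suc i) → refl }) φ))
    (Δ₀-separation (ren (ext ρ) φ) (Δ₀-ren (ext ρ) δ))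
Axiom-ren ρ (Δ₀-collection φ δ) =
  subst Axiom (cong₂ (λ ψ χ → All (All∈ v0 (Ex ψ) ⇒' Ex (All∈ v1 (Ex∈ v1 χ))))
    (ren-comm (lift2 1) (ext (ext ρ)) (ext (ext (ext ρ))) (lift2 1)
       (λ { zero → refl ; (suc zero) → refl ; (suc (suc i)) → refl }) φ)
    (ren-comm (lift2 2) (ext (ext ρ)) (ext (ext (ext (ext ρ)))) (lift2 2)
       (λ { zero → refl ; (suc zero) → refl ; (suc (suc i)) → refl }) φ))
    (Δ₀-collection (ren (ext (ext ρ)) φ) (Δ₀-ren (ext (ext ρ)) δ))
Axiom-ren ρ (setInduction φ) =
  subst Axiom (cong (λ ψ → All (All∈ v0 ψ ⇒' ren (ext ρ) φ) ⇒' All (ren (ext ρ) φ))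
    (ren-comm (lift1 1) (ext ρ) (ext (ext ρ)) (lift1 1) (λ { zero → refl ; (suc i) → refl }) φ))
    (setInduction (ren (ext ρ) φ))
Axiom-ren ρ strongInfinity = strongInfinity

⊢-ren : ∀ {k m} (ρ : Fin k → Fin m) {Γ : List (Fm k)} {φ} → Γ ⊢ φ → map (ren ρ) Γ ⊢ ren ρ φ
⊢-ren ρ (ax α)      = ax (Axiom-ren ρ α)
⊢-ren ρ (hyp i)     = hyp (∈-map⁺ (ren ρ) i)
⊢-ren ρ (⊥E d)      = ⊥E (⊢-ren ρ d)
⊢-ren ρ (∧I d e)    = ∧I (⊢-ren ρ d) (⊢-ren ρ e)
⊢-ren ρ (∧E₁ d)     = ∧E₁ (⊢-ren ρ d)
⊢-ren ρ (∧E₂ d)     = ∧E₂ (⊢-ren ρ d)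
⊢-ren ρ (∨I₁ d)     = ∨I₁ (⊢-ren ρ d)
⊢-ren ρ (∨I₂ d)     = ∨I₂ (⊢-ren ρ d)
⊢-ren ρ (∨E d e f)  = ∨E (⊢-ren ρ d) (⊢-ren ρ e) (⊢-ren ρ f)
⊢-ren ρ (⇒I d)      = ⇒I (⊢-ren ρ d)
⊢-ren ρ (⇒E d e)    = ⇒E (⊢-ren ρ d) (⊢-ren ρ e)
⊢-ren ρ {Γ} (∀I d)  = ∀I (subst (_⊢ _) (map-wk-ren ρ Γ) (⊢-ren (ext ρ) d))
⊢-ren ρ (∀E {φ = φ} d x) = cast (sym (ren-[] ρ x φ)) (∀E (⊢-ren ρ d) (ρ x))
⊢-ren ρ (∃I {φ = φ} x d) = ∃I (ρ x) (cast (ren-[] ρ x φ) (⊢-ren ρ d))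
⊢-ren ρ {Γ} (∃E {ψ = ψ} d e) = ∃E (⊢-ren ρ d)
  (subst₂ _⊢_ (cong (_ ∷_) (map-wk-ren ρ Γ)) (ren-comm (ext ρ) suc suc ρ (λ _ → refl) ψ) (⊢-ren (ext ρ) e))
⊢-ren ρ (≐refl x)   = ≐refl (ρ x)
⊢-ren ρ (≐subst φ {x} {y} d e) = cast (sym (ren-[] ρ y φ))
  (≐subst (ren (ext ρ) φ) (⊢-ren ρ d) (cast (ren-[] ρ x φ) (⊢-ren ρ e)))

⊢-wk : Γ ⊢ φ → map wk Γ ⊢ wk φ
⊢-wk = ⊢-ren suc

under : Γ ⊢ φ → (ψ ∷ map wk Γ) ⊢ wk φ
under d = up (⊢-wk d)

cut : Γ ⊢ φ → (φ ∷ Γ) ⊢ ψ → Γ ⊢ ψ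
cut d e = ⇒E (⇒I e) d

¬E : Γ ⊢ ¬' φ → Γ ⊢ φ → Γ ⊢ ψ
¬E d e = ⊥E (⇒E d e)

⇔I : (φ ∷ Γ) ⊢ ψ → (ψ ∷ Γ) ⊢ φ → Γ ⊢ φ ⇔' ψ
⇔I d e = ∧I (⇒I d) (⇒I e)

⇔E₁ : Γ ⊢ φ ⇔' ψ → Γ ⊢ φ → Γ ⊢ ψ
⇔E₁ d e = ⇒E (∧E₁ d) e

⇔E₂ : Γ ⊢ φ ⇔' ψ → Γ ⊢ ψ → Γ ⊢ φ
⇔E₂ d e = ⇒E (∧E₂ d) e

∀∈I : ∀ {x φ} → ((zero ε suc x) ∷ map wk Γ) ⊢ φ → Γ ⊢ All∈ x φ
∀∈I d = ∀I (⇒I d)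

∀∈E : ∀ {x φ} → Γ ⊢ All∈ x φ → (z : Fin n) → Γ ⊢ z ε x → Γ ⊢ φ [ z ]
∀∈E d z m = ⇒E (∀E d z) m

∃∈I : ∀ {x φ} (z : Fin n) → Γ ⊢ z ε x → Γ ⊢ φ [ z ] → Γ ⊢ Ex∈ x φ
∃∈I z m d = ∃I z (∧I m d)

∃∈E : ∀ {x φ ψ} → Γ ⊢ Ex∈ x φ → (φ ∷ (zero ε suc x) ∷ map wk Γ) ⊢ wk ψ → Γ ⊢ ψ
∃∈E d e = ∃E d (cut (∧E₁ h0) (cut (∧E₂ h1) (weaken (∷⁺ʳ _ (∷⁺ʳ _ (xs⊆x∷xs _ _))) e)))

⊆I : ∀ {x y} → ((zero ε suc x) ∷ map wk Γ) ⊢ (zero ε suc y) → Γ ⊢ Sub x y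
⊆I d = ∀I (⇒I d)

⊆E : ∀ {x y} → Γ ⊢ Sub x y → (z : Fin n) → Γ ⊢ z ε x → Γ ⊢ z ε y
⊆E d z m = ⇒E (∀E d z) m

≐sym : ∀ {x y} → Γ ⊢ x ≐ y → Γ ⊢ y ≐ x
≐sym {x = x} e = ≐subst (v0 ≐ suc x) e (≐refl x)

≐trans : ∀ {x y z} → Γ ⊢ x ≐ y → Γ ⊢ y ≐ z → Γ ⊢ x ≐ z
≐trans {x = x} e e′ = ≐subst (suc x ≐ v0) e′ e

ε-substˡ : ∀ {x y z} → Γ ⊢ x ≐ y → Γ ⊢ x ε z → Γ ⊢ y ε z
ε-substˡ {z = z} e m = ≐subst (v0 ε suc z) e m

ε-substʳ : ∀ {x y z} → Γ ⊢ x ≐ y → Γ ⊢ z ε x → Γ ⊢ z ε y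
ε-substʳ {z = z} e m = ≐subst (suc z ε v0) e m

≐-ext : ∀ {x y} → Γ ⊢ All ((v0 ε suc x) ⇔' (v0 ε suc y)) → Γ ⊢ x ≐ y
≐-ext {x = x} {y} d = ⇒E (∀E (∀E (ax extensionality) x) y) d

⊆-antisym : ∀ {x y} → Γ ⊢ Sub x y → Γ ⊢ Sub y x → Γ ⊢ x ≐ y
⊆-antisym d e = cut d (cut (up e) (≐-ext (∀I (⇔I (⊆E h2 v0 h0) (⊆E h1 v0 h0)))))

v4 : Fin (5 + n)
v4 = suc v3

v5 : Fin (6 + n)
v5 = suc v4

v6 : Fin (7 + n)
v6 = suc v5

v7 : Fin (8 + n)
v7 = suc v6

⊆-refl : (x : Fin n) → Γ ⊢ Sub x x
⊆-refl x = ⊆I h0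

≐⇒⊆ : ∀ {x y : Fin n} → Γ ⊢ x ≐ y → Γ ⊢ Sub x y
≐⇒⊆ {x = x} e = ≐subst (Sub (suc x) v0) e (⊆-refl x)

⊆-trans : ∀ {x y z : Fin n} → Γ ⊢ Sub x y → Γ ⊢ Sub y z → Γ ⊢ Sub x z
⊆-trans d e = cut d (cut (up e) (⊆I (⊆E h1 v0 (⊆E h2 v0 h0))))

Trans-∈ : ∀ {x y z : Fin n} → Γ ⊢ Trans x → Γ ⊢ y ε x → Γ ⊢ z ε y → Γ ⊢ z ε x
Trans-∈ {y = y} {z} d m m′ = ⊆E (∀∈E d y m) z m′

Ord-∈-Trans : ∀ {x y : Fin n} → Γ ⊢ Ord x → Γ ⊢ y ε x → Γ ⊢ Trans y
Ord-∈-Trans {y = y} d m = ∀∈E (∧E₂ d) y m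

Ord-∈ : ∀ {x y : Fin n} → Γ ⊢ Ord x → Γ ⊢ y ε x → Γ ⊢ Ord y
Ord-∈ d m = ∧I (Ord-∈-Trans d m) (cut d (cut (up m) (∀∈I (Ord-∈-Trans h2 (Trans-∈ (∧E₁ h2) h1 h0)))))

ε-irrefl : (x : Fin n) → Γ ⊢ ¬' (x ε x)
ε-irrefl x = ∀E (⇒E (ax (setInduction (¬' (v0 ε v0)))) (∀I (⇒I (⇒I (⇒E (∀∈E h1 v0 h0) h0))))) x

relpl-refl : (x : Fin n) → Γ ⊢ relpl x x
relpl-refl x = ∀∈I (∀∈I (⇒I h1))

Empty : Fin n → Fm n
Empty e = All (¬' (v0 ε suc e))

Empty-elim : ∀ {e z : Fin n} → Γ ⊢ Empty e → Γ ⊢ z ε e → Γ ⊢ φ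
Empty-elim {z = z} d m = ¬E (∀E d z) m

Empty-Ord : ∀ {e : Fin n} → Γ ⊢ Empty e → Γ ⊢ Ord e
Empty-Ord d = ∧I (∀∈I (Empty-elim (under d) h0)) (∀∈I (Empty-elim (under d) h0))

⊆-Empty : ∀ {e z : Fin n} → Γ ⊢ Empty e → Γ ⊢ Sub z e → Γ ⊢ z ≐ e
⊆-Empty d s = ⊆-antisym s (⊆I (Empty-elim (under d) h0))

≐-Empty-elim : ∀ {e z w : Fin n} → Γ ⊢ Empty e → Γ ⊢ z ≐ e → Γ ⊢ w ε z → Γ ⊢ φ
≐-Empty-elim d q m = Empty-elim d (ε-substʳ q m)

≐-Empty⇒⊆ : ∀ {e d z : Fin n} → Γ ⊢ Empty e → Γ ⊢ d ≐ e → Γ ⊢ Sub d z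
≐-Empty⇒⊆ em q = cut q (⊆I (≐-Empty-elim (under (up em)) h1 h0))

relpl-Empty : ∀ {e z : Fin n} → Γ ⊢ Empty e → Γ ⊢ relpl e z
relpl-Empty d = ∀∈I (∀∈I (Empty-elim (under (under d)) h0))

Adjoin : Fin n → Fin n → Fin n → Fm n
Adjoin S s c = All ((v0 ε suc S) ⇔' ((v0 ε suc s) ∨' (v0 ≐ suc c)))

∈-Adjoinˡ : ∀ {S s c z : Fin n} → Γ ⊢ Adjoin S s c → Γ ⊢ z ε s → Γ ⊢ z ε S
∈-Adjoinˡ {z = z} d m = ⇔E₂ (∀E d z) (∨I₁ m)

∈-Adjoinʳ : ∀ {S s c z : Fin n} → Γ ⊢ Adjoin S s c → Γ ⊢ z ≐ c → Γ ⊢ z ε S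
∈-Adjoinʳ {z = z} d e = ⇔E₂ (∀E d z) (∨I₂ e)

Adjoin-elim : ∀ {S s c z : Fin n} → Γ ⊢ Adjoin S s c → Γ ⊢ z ε S → Γ ⊢ (z ε s) ∨' (z ≐ c)
Adjoin-elim {z = z} d m = ⇔E₁ (∀E d z) m

Adjoin-Empty-elim : ∀ {e S c z : Fin n} → Γ ⊢ Empty e → Γ ⊢ Adjoin S e c → Γ ⊢ z ε S → Γ ⊢ z ≐ c
Adjoin-Empty-elim em d m = ∨E (Adjoin-elim d m) (Empty-elim (up em) h0) h0

Adjoin-∃ : (s c : Fin n) → Γ ⊢ Ex (Adjoin v0 (suc s) (suc c))
Adjoin-∃ s c =
  ∃E (∀E (∀E (ax pairing) c) c)
  (∃E (∀E (∀E (ax pairing) (suc s)) v0)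
  (∃E (∀E (ax union) v0)
  (∃E (∀E (ax (Δ₀-separation ((v0 ε suc (suc (suc (suc s)))) ∨' (v0 ≐ suc (suc (suc (suc c)))))
                  (or (mem _ _) (eq _ _)))) v0)
  (∃I v0 (∀I (⇔I (∧E₂ (⇔E₁ (∀E h1 v0) h0))
     (⇔E₂ (∀E h1 v0) (∧I (∨E h0 (∀∈E (∀∈E h3 _ (∧E₁ h4)) v0 h0)
                                 (ε-substˡ (≐sym h0) (∀∈E (∀∈E h3 v4 (∧E₂ h4)) _ (∧E₁ h5))))
                          h0))))))))

Ord-suc : ∀ {s x : Fin n} → Γ ⊢ Ord x → Γ ⊢ Adjoin s x x → Γ ⊢ Ord s
Ord-suc ox d = cut ox (cut (up d)
  (∧I (∀∈I (⊆I (⇔E₂ (∀E h2 v0) (∨I₁ (∨E (⇔E₁ (∀E h2 v1) h1) (Trans-∈ (∧E₁ h4) h0 h1) (ε-substʳ h0 h1))))))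
      (∀∈I (∨E (⇔E₁ (∀E h1 v0) h0) (Ord-∈-Trans h3 h0) (≐subst (Trans v0) (≐sym h0) (∧E₁ h3))))))

UPair-∃ : (a b : Fin n) → Γ ⊢ Ex (All ((v0 ε v1) ⇔' ((v0 ≐ suc (suc a)) ∨' (v0 ≐ suc (suc b)))))
UPair-∃ a b =
  ∃E (∀E (∀E (ax pairing) a) b)
  (∃E (∀E (ax (Δ₀-separation ((v0 ≐ suc (suc a)) ∨' (v0 ≐ suc (suc b))) (or (eq _ _) (eq _ _)))) v0)
  (∃I v0 (∀I (⇔I (∧E₂ (⇔E₁ (∀E h1 v0) h0))
     (⇔E₂ (∀E h1 v0) (∧I (∨E h0 (ε-substˡ (≐sym h0) (∧E₁ h3)) (ε-substˡ (≐sym h0) (∧E₂ h3))) h0))))))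

Pair-∃ : (a b : Fin n) → Γ ⊢ Ex (Pair v0 (suc a) (suc b))
Pair-∃ a b =
  ∃E (UPair-∃ a a)
  (∃E (UPair-∃ (suc a) (suc b))
  (∃E (UPair-∃ v1 v0)
  (∃I v0
    (cut (∧I (⇔E₂ (∀E h2 _) (∨I₁ (≐refl _))) (∀∈I (∨E (⇔E₁ (∀E h3 v0) h0) h0 h0)))
    (cut (∧I (⇔E₂ (∀E h2 _) (∨I₁ (≐refl _))) (∧I (⇔E₂ (∀E h2 _) (∨I₂ (≐refl _))) (∀∈I (⇔E₁ (∀E h3 v0) h0))))
      (∧I (∃∈I v2 (⇔E₂ (∀E h2 v2) (∨I₁ (≐refl _))) h1)
      (∧I (∃∈I v1 (⇔E₂ (∀E h2 v1) (∨I₂ (≐refl _))) h0)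
          (∀∈I (∨E (⇔E₁ (∀E h3 v0) h0)
                   (∨I₁ (≐subst (Sing v0 (suc (suc (suc (suc (suc a)))))) (≐sym h0) h3))
                   (∨I₂ (≐subst (Dbl v0 (suc (suc (suc (suc (suc a))))) (suc (suc (suc (suc (suc b))))))
                                (≐sym h0) h2)))))))))))

Pair-injˡ : ∀ {p a b a′ b′ : Fin n} → Γ ⊢ Pair p a b → Γ ⊢ Pair p a′ b′ → Γ ⊢ a ≐ a′
Pair-injˡ P P′ = cut P (cut (up P′) (∃∈E (∧E₁ h1)
  (∨E (∀∈E (∧E₂ (∧E₂ h2)) v0 h1)
      (∀∈E (∧E₂ h0) _ (∧E₁ h1))
      (≐sym (∀∈E (∧E₂ h1) _ (∧E₁ h0))))))

Pair-injʳ : ∀ {p a b a′ b′ : Fin n} → Γ ⊢ Pair p a b → Γ ⊢ Pair p a′ b′ → Γ ⊢ b ≐ b′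
Pair-injʳ {Γ = Γ} {p = p} {a} {b} {a′} {b′} P P′ = cut P (cut (up P′) (cut (Pair-injˡ h1 h0) (cut b≐a′⇒b≐b′
  (∃∈E (∧E₁ (∧E₂ h3))
    (∨E (∀∈E (∧E₂ (∧E₂ h4)) v0 h1)
        (⇒E h3 (∀∈E (∧E₂ h0) _ (∧E₁ (∧E₂ h1))))
        (∨E (∀∈E (∧E₂ (∧E₂ h0)) _ (∧E₁ (∧E₂ h1))) (⇒E h4 h0) h0))))))
  where
  b≐a′⇒b≐b′ : ((a ≐ a′) ∷ Pair p a′ b′ ∷ Pair p a b ∷ Γ) ⊢ (b ≐ a′) ⇒' (b ≐ b′)
  b≐a′⇒b≐b′ = ⇒I (∃∈E (∧E₁ (∧E₂ h2))
    (∨E (∀∈E (∧E₂ (∧E₂ h5)) v0 h1)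
        (≐trans h3 (≐trans (≐sym h4) (≐sym (∀∈E (∧E₂ h0) _ (∧E₁ (∧E₂ h1))))))
        (∨E (∀∈E (∧E₂ (∧E₂ h0)) _ (∧E₁ (∧E₂ h1)))
            (≐trans h4 (≐trans (≐sym h5) (≐sym h0)))
            (≐sym h0))))

Pair-≐-inj : ∀ {p q a b a′ b′ : Fin n} → Γ ⊢ p ≐ q → Γ ⊢ Pair p a b → Γ ⊢ Pair q a′ b′ → Γ ⊢ (a ≐ a′) ∧' (b ≐ b′)
Pair-≐-inj {Γ = Γ} {q = q} {a = a} {b} e P Q = ∧I (≐sym (Pair-injˡ Q P′)) (≐sym (Pair-injʳ Q P′))
  where
  P′ : Γ ⊢ Pair q a b
  P′ = ≐subst (Pair v0 (suc a) (suc b)) e P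

REM′ : Fm n
REM′ = All (All ((v1 ε v0) ∨' ¬' (v1 ε v0)))

REM-ε : Γ ⊢ REM′ → (x y : Fin n) → Γ ⊢ (x ε y) ∨' ¬' (x ε y)
REM-ε r x y = ∀E (∀E r x) y

-- ψ holds iff ∅ ∈ {z ∈ {∅} | ψ}, and REM decides the latter.
REM⇒Δ₀-EM : Γ ⊢ REM′ → (ψ : Fm n) → Δ₀ ψ → Γ ⊢ ψ ∨' ¬' ψ
REM⇒Δ₀-EM r ψ δ =
  ∃E (ax emptySet)
  (∃E (∀E (∀E (ax pairing) v0) v0)
  (∃E (∀E (ax (Δ₀-separation (ren shift ψ) (Δ₀-ren shift δ))) v0)
  (cut (cast (cong (λ χ → (v2 ε v0) ⇔' ((v2 ε v1) ∧' χ)) sep-instance) (∀E h0 v2))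
  (∨E (REM-ε (up (under (under (under r)))) v2 v0)
     (∨I₁ (∧E₂ (⇔E₁ h1 h0)))
     (∨I₂ (⇒I (¬E h1 (⇔E₂ h2 (∧I (∧E₁ h4) h0)))))))))
  where
  shift : Fin _ → Fin (3 + _)
  shift i = suc (suc (suc i))
  sep-instance : ren (sub0 v2) (ren (ext (ext (sub0 v0))) (ren (lift1 2) (ren shift ψ))) ≡ wk (wk (wk ψ))
  sep-instance = trans (ren-∘ (λ _ → refl) _) (trans (ren-∘ (λ _ → refl) _) (trans (ren-∘ (λ _ → refl) ψ)
                 (sym (trans (ren-∘ (λ _ → refl) _) (ren-∘ (λ _ → refl) ψ)))))

Trichotomous : Fin n → Fin n → Fm n
Trichotomous a b = (a ε b) ∨' ((a ≐ b) ∨' (b ε a))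

-- Double ∈-induction: deciding the Δ₀ formulas ∃z∈x (y ∈ z ∨ y = z) and ∃z∈y (x ∈ z ∨ x = z) settles
-- y ∈ x resp. x ∈ y; if both fail, the induction hypotheses give x = y.
REM⇒Ord-trichotomous : Γ ⊢ REM′ → (x y : Fin n) → Γ ⊢ Ord x → Γ ⊢ Ord y → Γ ⊢ Trichotomous x y
REM⇒Ord-trichotomous {Γ = Γ} r x y ox oy =
  ⇒E (∀E (⇒E (∀E (⇒E (ax (setInduction Claim)) (∀I (⇒I (⇒I outer)))) x) ox) y) oy
  where
  Claim : ∀ {k} → Fm (suc k)
  Claim = Ord v0 ⇒' All (Ord v0 ⇒' Trichotomous v1 v0)
  outer : (Ord v0 ∷ All∈ v0 Claim ∷ map wk Γ) ⊢ All (Ord v0 ⇒' Trichotomous v1 v0)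
  outer = ⇒E (ax (setInduction (Ord v0 ⇒' Trichotomous v1 v0))) (∀I (⇒I (⇒I inner)))
    where
    Ctx : List (Fm _)
    Ctx = Ord v0 ∷ All∈ v0 (Ord v0 ⇒' Trichotomous v2 v0) ∷ map wk (Ord v0 ∷ All∈ v0 Claim ∷ map wk Γ)
    r′ : Ctx ⊢ REM′
    r′ = up (under (up (under r)))
    inner : Ctx ⊢ Trichotomous v1 v0
    inner = ∨E (REM⇒Δ₀-EM r′ (Ex∈ v1 ((v1 ε v0) ∨' (v1 ≐ v0))) (bex v1 (or (mem v1 v0) (eq v1 v0))))
             (∃∈E h0 (∨E h0 (∨I₂ (∨I₂ (Trans-∈ (∧E₁ h6) h2 h0))) (∨I₂ (∨I₂ (ε-substˡ (≐sym h0) h2)))))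
             (∨E (REM⇒Δ₀-EM (up r′) (Ex∈ v0 ((v2 ε v0) ∨' (v2 ≐ v0))) (bex v0 (or (mem v2 v0) (eq v2 v0))))
                 (∨I₁ (∃∈E h0 (∨E h0 (Trans-∈ (∧E₁ h5) h2 h0) (ε-substˡ (≐sym h0) h2))))
                 (∨I₂ (∨I₁ (⊆-antisym
                   (⊆I (∨E (⇒E (∀E (⇒E (∀∈E h6 v0 h0) (Ord-∈ h5 h0)) v1) h3)
                      h0
                      (∨E h0 (¬E h4 (∃∈I v0 h2 (∨I₂ (≐sym h0)))) (¬E h4 (∃∈I v0 h2 (∨I₁ h0))))))
                   (⊆I (∨E (⇒E (∀∈E h4 v0 h0) (Ord-∈ h3 h0))
                      (¬E h2 (∃∈I v0 h1 (∨I₁ h0)))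
                      (∨E h0 (¬E h3 (∃∈I v0 h2 (∨I₂ h0))) h0)))))))

-- ∈-induction on c: if some d ∈ c lies outside g, trichotomy gives g ⊆ d and relpl_d(g), so g ∈ c by the
-- induction hypothesis at d; otherwise c ⊆ g, so g = c.
REM⇒relpl-⊆ : Γ ⊢ REM′ → (c g : Fin n) → Γ ⊢ Ord c → Γ ⊢ Sub g c → Γ ⊢ relpl c g → Γ ⊢ (g ε c) ∨' (g ≐ c)
REM⇒relpl-⊆ {n = n} {Γ = Γ} r c g oc g⊆c rel =
  ⇒E (⇒E (∀E (⇒E (∀E (⇒E (ax (setInduction Claim)) (∀I (⇒I (⇒I (∀I (⇒I (⇒I step))))))) c) oc) g) g⊆c) rel
  where
  Claim : ∀ {k} → Fm (suc k)
  Claim = Ord v0 ⇒' All (Sub v0 v1 ⇒' relpl v1 v0 ⇒' ((v0 ε v1) ∨' (v0 ≐ v1)))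
  Ctx₂ : List (Fm (2 + n))
  Ctx₂ = relpl v1 v0 ∷ Sub v0 v1 ∷ map wk (Ord v0 ∷ All∈ v0 Claim ∷ map wk Γ)
  r₂ : Ctx₂ ⊢ REM′
  r₂ = up (under (up (under r)))
  Outside : Fm (2 + n)
  Outside = Ex∈ v1 (¬' (v0 ε v1))
  Ctx₃ : List (Fm (3 + n))
  Ctx₃ = ¬' (v0 ε v1) ∷ (v0 ε v2) ∷ map wk (Outside ∷ Ctx₂)
  r₃ : Ctx₃ ⊢ REM′
  r₃ = up (under (up r₂))
  g⊆d : Ctx₃ ⊢ Sub v1 v0
  g⊆d = ⊆I (∨E (REM⇒Ord-trichotomous (under r₃) v0 v1 (Ord-∈ h6 (⊆E h5 v0 h0)) (Ord-∈ h6 h2))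
               h0
               (∨E h0 (¬E h3 (ε-substˡ h0 h2))
                  (¬E h3 (⇒E (∀∈E (∀∈E h6 v0 h2) v1 h4)
                              (∀∈E (Ord-∈-Trans h8 (⊆E h7 v0 h2)) v1 h0)))))
  relpl-d : Ctx₃ ⊢ relpl v0 v1
  relpl-d = ∀∈I (∀∈I (⇒I (⇒E (∀∈E (∀∈E h6 v1 h2) v0 (Trans-∈ (∧E₁ h8) h4 h1)) h0)))
  below : Ctx₃ ⊢ wk ((v0 ε v1) ∨' (v0 ≐ v1))
  below = cut g⊆d (cut (up relpl-d)
          (∨I₁ (∨E (⇒E (⇒E (∀E (⇒E (∀∈E h8 v0 h3) (Ord-∈ h7 h3)) v1) h1) h0)
                   (Trans-∈ (∧E₁ h8) h4 h0)
                   (ε-substˡ (≐sym h0) h4))))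
  step : Ctx₂ ⊢ (v0 ε v1) ∨' (v0 ≐ v1)
  step = ∨E (REM⇒Δ₀-EM r₂ Outside (bex v1 (imp (mem v0 v1) bot)))
            (∃∈E h0 below)
            (∨I₂ (⊆-antisym h2 (⊆I (∨E (REM-ε (under (up r₂)) v0 v1) h0 (¬E h2 (∃∈I v0 h1 h0))))))

REM⇒PlOrd : ∀ {s : Fin n} → Γ ⊢ REM′ → Γ ⊢ Ord s → Γ ⊢ PlOrd s
REM⇒PlOrd r os = cut os (∧I h0 (∀∈I (∀I (⇒I (⇒I
  (∨E (REM⇒relpl-⊆ (up (up (⊢-wk (under (up r))))) v1 v0 (Ord-∈ h3 h2) h1
          (∀∈I (∀∈I (⇒I (⇒E (∀∈E (∀∈E h3 v1 h2) v0 (Trans-∈ (∧E₁ h6) h5 h1)) h0)))))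
      (∧I (Trans-∈ (∧E₁ h4) h3 h0) (∀∈I (⇒I (Trans-∈ (Ord-∈-Trans h6 h1) h0 h2))))
      (∧I (ε-substˡ (≐sym h0) h3) (∀∈I (⇒I (ε-substˡ (≐sym h2) h0))))))))))

REM⇒PlUb : Γ ⊢ REM′ → Γ ⊢ PlUb
REM⇒PlUb r = ∀I (⇒I (∃E (Adjoin-∃ v0 v0)
  (∃I v0 (∧I (REM⇒PlOrd (under (under r)) (Ord-suc (∧E₁ h1) h0)) (⇔E₂ (∀E h0 v1) (∨I₂ (≐refl v1)))))))

PlFixed : Fm (suc n)
PlFixed = Ord v0 ⇒' All (All ((PlAttempt v1 ∧' PairIn v1 v2 v0) ⇒' (v2 ≐ v0)))

-- By ∈-induction c^pl = c for all c ∈ a, so a^pl = ⋃_{c ∈ a} c^pl+ = a, since under REM each z ∈ c^pl+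
-- is ∈ or = c.
REM⇒PlFixed : ∀ {n} {Γ : List (Fm n)} → Γ ⊢ REM′ → Γ ⊢ All PlFixed
REM⇒PlFixed {n} {Γ} r = ⇒E (ax (setInduction PlFixed)) (∀I (⇒I (⇒I (∀I (∀I (⇒I step))))))
  where
  Ctx₃ : List (Fm (3 + n))
  Ctx₃ = (PlAttempt v1 ∧' PairIn v1 v2 v0) ∷ map wk (map wk (Ord v0 ∷ All∈ v0 PlFixed ∷ map wk Γ))
  Ctx₄ : List (Fm (4 + n))
  Ctx₄ = Pair v0 v3 v1 ∷ (v0 ε v2) ∷ map wk Ctx₃
  total : Ctx₄ ⊢ All∈ v3 (Ex (PairIn v4 v1 v0))
  total = ∧E₁ (⇒E (∀E (∀E (∀∈E (∧E₁ h2) v0 h1) v3) v1) h0)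
  recursion : Ctx₄ ⊢ All ((v0 ε v2) ⇔' Ex∈ v4 (Ex (PairIn v5 v1 v0 ∧' InPlSucc v2 v0)))
  recursion = ∧E₂ (⇒E (∀E (∀E (∀∈E (∧E₁ h2) v0 h1) v3) v1) h0)
  Ctx₄′ : List (Fm (4 + n))
  Ctx₄′ = All ((v0 ε v2) ⇔' Ex∈ v4 (Ex (PairIn v5 v1 v0 ∧' InPlSucc v2 v0))) ∷ All∈ v3 (Ex (PairIn v4 v1 v0)) ∷ Ctx₄
  r₄ : Ctx₄′ ⊢ REM′
  r₄ = up (up (up (under (up (⊢-wk (⊢-wk (up (under r))))))))
  a⊆y : Ctx₄′ ⊢ Sub v3 v1
  a⊆y = ⊆I (∃E (∀∈E h2 v0 h0)
         (cut (⇒E (∀E (∀E (⇒E (∀∈E h8 v1 h1) (Ord-∈ h7 h1)) v4) v0) (∧I (∧E₁ h6) h0))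
           (⇔E₂ (∀E h3 v1) (∃∈I v1 h2 (∃I v0 (∧I h1 (∧I (≐⇒⊆ h0) (≐subst (relpl v0 v2) h0 (relpl-refl v1)))))))))
  y⊆a : Ctx₄′ ⊢ Sub v1 v3
  y⊆a = ⊆I (∃∈E (⇔E₁ (∀E h1 v0) h0)
         (∃E h0
           (cut (⇒E (∀E (∀E (⇒E (∀∈E h10 v1 h2) (Ord-∈ h9 h2)) v5) v0) (∧I (∧E₁ h8) (∧E₁ h0)))
             (∨E (REM⇒relpl-⊆ (up (under (up (under (under r₄))))) v1 v2 (Ord-∈ h10 h3)
                    (≐subst (Sub v3 v0) (≐sym h0) (∧E₁ (∧E₂ h1)))
                    (≐subst (relpl v0 v3) (≐sym h0) (∧E₂ (∧E₂ h1))))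
                 (Trans-∈ (∧E₁ h11) h4 h0)
                 (ε-substˡ (≐sym h0) h4)))))
  step : Ctx₃ ⊢ v2 ≐ v0
  step = ∃∈E (∧E₂ h0) (cut total (cut (up recursion) (⊆-antisym a⊆y y⊆a)))

REM⇒PlG-≐ : ∀ {a y : Fin n} → Γ ⊢ REM′ → Γ ⊢ Ord a → Γ ⊢ PlG a y → Γ ⊢ a ≐ y
REM⇒PlG-≐ {a = a} r oa g = ∃E g (⇒E (∀E (∀E (⇒E (∀E (REM⇒PlFixed (under r)) (suc a)) (under oa)) v0) _) h0)

REM⇒Cond1 : (REM ∷ []) ⊢ Cond1
REM⇒Cond1 = ∧I (REM⇒PlUb h0) (∀I (∀I (∀I (⇒I
  (≐trans (REM⇒PlG-≐ r (∧E₁ h0) (∧E₁ (∧E₂ (∧E₂ h0)))) (≐sym (REM⇒PlG-≐ r (∧E₁ (∧E₂ h0)) (∧E₂ (∧E₂ (∧E₂ h0))))))))))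
  where
  r : (φ ∷ map wk (map wk (map wk (REM ∷ [])))) ⊢ REM′
  r = up (⊢-wk (⊢-wk (⊢-wk h0)))

TruthValue : Fin n → Fin n → Fin n → Fin n → Fm n
TruthValue A e x y = All ((v0 ε suc A) ⇔' ((v0 ≐ suc e) ∧' (suc x ε suc y)))

PowerSet : Fin n → Fin n → Fm n
PowerSet p o = All ((v0 ε suc p) ⇔' Sub v0 (suc o))

AmongFive : Fin n → Fin n → Fin n → Fin n → Fin n → Fin n → Fm n
AmongFive f a b c d e =
  All ((v0 ε suc f) ⇒' ((v0 ≐ suc a) ∨' ((v0 ≐ suc b) ∨' ((v0 ≐ suc c) ∨' ((v0 ≐ suc d) ∨' (v0 ≐ suc e))))))

FiveSet : Fin n → Fin n → Fin n → Fin n → Fin n → Fin n → Fm n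
FiveSet f a b c d e = AmongFive f a b c d e ∧' ((a ε f) ∧' ((b ε f) ∧' ((c ε f) ∧' ((d ε f) ∧' (e ε f)))))

TruthValue-∃ : ∀ {e o : Fin n} (x y : Fin n) → Γ ⊢ Adjoin o e e → Γ ⊢ Ex (TruthValue v0 (suc e) (suc x) (suc y))
TruthValue-∃ {e = e} {o} x y d = cut d
  (∃E (∀E (ax (Δ₀-separation ((v0 ≐ suc e) ∧' (suc x ε suc y)) (and (eq _ _) (mem _ _)))) o)
  (∃I v0 (∀I (⇔I (∧E₂ (⇔E₁ (∀E h1 v0) h0)) (⇔E₂ (∀E h1 v0) (∧I (∈-Adjoinʳ h2 (∧E₁ h0)) h0))))))

PlOrd-singleton-∅ : ∀ {e o : Fin n} → Γ ⊢ Empty e → Γ ⊢ Adjoin o e e → Γ ⊢ PlOrd o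
PlOrd-singleton-∅ em d = ∧I (Ord-suc (Empty-Ord em) d)
  (cut em (cut (up d) (∀∈I (∀I (⇒I (⇒I
    (cut (⊆-Empty h4 (⊆-trans h1 (≐⇒⊆ (Adjoin-Empty-elim h4 h3 h2))))
      (∧I (∈-Adjoinʳ h4 h0)
          (∀∈I (⇒I (Empty-elim h7 (ε-substʳ (Adjoin-Empty-elim h7 h6 h1) h0))))))))))))

-- PlUb gives a plump ordinal β ∋ {∅}; every subset of {∅} is relatively plump in β, hence in β,
-- and P = {z ∈ β | z ⊆ {∅}}.
PlUb⇒PowerSet-singleton-∅ : ∀ {e o : Fin n} → Γ ⊢ Empty e → Γ ⊢ Adjoin o e e → Γ ⊢ PlUb → Γ ⊢ Ex (PowerSet v0 (suc o))
PlUb⇒PowerSet-singleton-∅ {o = o} em d pu = cut em (cut (up d)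
  (∃E (⇒E (∀E (up (up pu)) o) (PlOrd-singleton-∅ h1 h0))
  (∃E (∀E (ax (Δ₀-separation (Sub v0 (suc (suc o))) (ball _ (mem _ _)))) v0)
  (∃I v0 (∀I (⇔I (∧E₂ (⇔E₁ (∀E h1 v0) h0))
     (⇔E₂ (∀E h1 v0) (∧I
        (∧E₁ (⇒E (⇒E (∀E (∀∈E (∧E₂ (∧E₁ h2)) _ (∧E₂ h2)) v0) h0)
           (∀∈I (∀∈I (⇒I
             (ε-substˡ (≐trans (Adjoin-Empty-elim h7 h6 (⊆E h3 _ h2))
                     (≐sym (⊆-Empty h7 (⊆-trans h0 (≐⇒⊆ (Adjoin-Empty-elim h7 h6 (⊆E h3 _ h2)))))))
                   h2))))))
        h0))))))))

FiveSet-∃ : ∀ {e : Fin n} (a b c d g : Fin n) → Γ ⊢ Empty e →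
            Γ ⊢ Ex (FiveSet v0 (suc a) (suc b) (suc c) (suc d) (suc g))
FiveSet-∃ {e = e} a b c d g em = cut em
  (∃E (Adjoin-∃ e a)
  (∃E (Adjoin-∃ v0 (suc b))
  (∃E (Adjoin-∃ v0 (suc (suc c)))
  (∃E (Adjoin-∃ v0 (suc (suc (suc d))))
  (∃E (Adjoin-∃ v0 (suc (suc (suc (suc g)))))
  (∃I v0 (∧I
    (∀I (⇒I (∨E (Adjoin-elim h1 h0)
      (∨E (Adjoin-elim h3 h0)
        (∨E (Adjoin-elim h5 h0)
          (∨E (Adjoin-elim h7 h0)
            (∨E (Adjoin-elim h9 h0) (Empty-elim h11 h0) (∨I₁ h0))
            (∨I₂ (∨I₁ h0)))
          (∨I₂ (∨I₂ (∨I₁ h0))))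
        (∨I₂ (∨I₂ (∨I₂ (∨I₁ h0)))))
      (∨I₂ (∨I₂ (∨I₂ (∨I₂ h0)))))))
    (∧I (∈-Adjoinˡ h0 (∈-Adjoinˡ h1 (∈-Adjoinˡ h2 (∈-Adjoinˡ h3 (∈-Adjoinʳ h4 (≐refl _))))))
    (∧I (∈-Adjoinˡ h0 (∈-Adjoinˡ h1 (∈-Adjoinˡ h2 (∈-Adjoinʳ h3 (≐refl _)))))
    (∧I (∈-Adjoinˡ h0 (∈-Adjoinˡ h1 (∈-Adjoinʳ h2 (≐refl _))))
    (∧I (∈-Adjoinˡ h0 (∈-Adjoinʳ h1 (≐refl _)))
        (∈-Adjoinʳ h0 (≐refl _)))))))))))))

∨E₅ : ∀ {φ₁ φ₂ φ₃ φ₄ φ₅ : Fm n} → Γ ⊢ φ₁ ∨' (φ₂ ∨' (φ₃ ∨' (φ₄ ∨' φ₅))) →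
      (φ₁ ∷ Γ) ⊢ χ → (φ₂ ∷ Γ) ⊢ χ → (φ₃ ∷ Γ) ⊢ χ → (φ₄ ∷ Γ) ⊢ χ → (φ₅ ∷ Γ) ⊢ χ → Γ ⊢ χ
∨E₅ d e₁ e₂ e₃ e₄ e₅ =
  ∨E d e₁ (∨E h0 (skip e₂) (∨E h0 (skip (skip e₃)) (∨E h0 (skip (skip (skip e₄))) (skip (skip (skip e₅))))))
  where
  skip : ∀ {k} {Θ : List (Fm k)} {θ θ′ ϑ} → (θ ∷ Θ) ⊢ ϑ → (θ ∷ θ′ ∷ Θ) ⊢ ϑ
  skip = weaken (∷⁺ʳ _ there)

PairIn-≐⇒∃ : ∀ {F a b c : Fin n} → Γ ⊢ PairIn F a b → Γ ⊢ c ≐ a → Γ ⊢ Ex (PairIn (suc F) (suc c) v0)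
PairIn-≐⇒∃ {F = F} {b = b} p q = ∃I b (≐subst (PairIn (suc F) v0 (suc b)) (≐sym q) p)

record Names (n : ℕ) : Set where
  field x y 𝟘 𝟙 𝟚 A α P q₁ q₂ q₃ q₄ q₅ f : Fin n
open Names public

wkNames : Names n → Names (suc n)
wkNames V = record
  { x = suc (x V) ; y = suc (y V) ; 𝟘 = suc (𝟘 V) ; 𝟙 = suc (𝟙 V) ; 𝟚 = suc (𝟚 V) ; A = suc (A V)
  ; α = suc (α V) ; P = suc (P V) ; q₁ = suc (q₁ V) ; q₂ = suc (q₂ V) ; q₃ = suc (q₃ V) ; q₄ = suc (q₄ V) ; q₅ = suc (q₅ V) ; f = suc (f V) }

-- α = 𝟚 ∪ {A} with A = {𝟘 | x ∈ y}, P = 𝒫(𝟙), and f = {⟨𝟘,𝟘⟩, ⟨𝟙,𝟙⟩, ⟨A,A⟩, ⟨α,P⟩, ⟨𝟚,P⟩}.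
record Setup (Γ : List (Fm n)) (V : Names n) : Set where
  field
    𝟘-empty : Γ ⊢ Empty (𝟘 V)
    𝟙-def   : Γ ⊢ Adjoin (𝟙 V) (𝟘 V) (𝟘 V)
    𝟚-def   : Γ ⊢ Adjoin (𝟚 V) (𝟙 V) (𝟙 V)
    A-def   : Γ ⊢ TruthValue (A V) (𝟘 V) (x V) (y V)
    α-def   : Γ ⊢ Adjoin (α V) (𝟚 V) (A V)
    P-def   : Γ ⊢ PowerSet (P V) (𝟙 V)
    q₁-pair : Γ ⊢ Pair (q₁ V) (𝟘 V) (𝟘 V)
    q₂-pair : Γ ⊢ Pair (q₂ V) (𝟙 V) (𝟙 V)
    q₃-pair : Γ ⊢ Pair (q₃ V) (A V) (A V)
    q₄-pair : Γ ⊢ Pair (q₄ V) (α V) (P V)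
    q₅-pair : Γ ⊢ Pair (q₅ V) (𝟚 V) (P V)
    f-among : Γ ⊢ AmongFive (f V) (q₁ V) (q₂ V) (q₃ V) (q₄ V) (q₅ V)
    q₁∈f    : Γ ⊢ q₁ V ε f V
    q₂∈f    : Γ ⊢ q₂ V ε f V
    q₃∈f    : Γ ⊢ q₃ V ε f V
    q₄∈f    : Γ ⊢ q₄ V ε f V
    q₅∈f    : Γ ⊢ q₅ V ε f V
open Setup public

private variable
  V : Names n

infixl 20 _⁺ _ʷ _↑

_⁺ : Setup Γ V → Setup (ψ ∷ Γ) V
E ⁺ = record
  { 𝟘-empty = up (𝟘-empty E) ; 𝟙-def = up (𝟙-def E) ; 𝟚-def = up (𝟚-def E) ; A-def = up (A-def E)
  ; α-def = up (α-def E) ; P-def = up (P-def E) ; q₁-pair = up (q₁-pair E) ; q₂-pair = up (q₂-pair E)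
  ; q₃-pair = up (q₃-pair E) ; q₄-pair = up (q₄-pair E) ; q₅-pair = up (q₅-pair E) ; f-among = up (f-among E)
  ; q₁∈f = up (q₁∈f E) ; q₂∈f = up (q₂∈f E) ; q₃∈f = up (q₃∈f E) ; q₄∈f = up (q₄∈f E) ; q₅∈f = up (q₅∈f E) }

_ʷ : Setup Γ V → Setup (map wk Γ) (wkNames V)
E ʷ = record
  { 𝟘-empty = ⊢-wk (𝟘-empty E) ; 𝟙-def = ⊢-wk (𝟙-def E) ; 𝟚-def = ⊢-wk (𝟚-def E) ; A-def = ⊢-wk (A-def E)
  ; α-def = ⊢-wk (α-def E) ; P-def = ⊢-wk (P-def E) ; q₁-pair = ⊢-wk (q₁-pair E) ; q₂-pair = ⊢-wk (q₂-pair E)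
  ; q₃-pair = ⊢-wk (q₃-pair E) ; q₄-pair = ⊢-wk (q₄-pair E) ; q₅-pair = ⊢-wk (q₅-pair E) ; f-among = ⊢-wk (f-among E)
  ; q₁∈f = ⊢-wk (q₁∈f E) ; q₂∈f = ⊢-wk (q₂∈f E) ; q₃∈f = ⊢-wk (q₃∈f E) ; q₄∈f = ⊢-wk (q₄∈f E) ; q₅∈f = ⊢-wk (q₅∈f E) }

_↑ : Setup Γ V → Setup (ψ ∷ map wk Γ) (wkNames V)
E ↑ = E ʷ ⁺

module _ {n : ℕ} {Γ : List (Fm n)} {V : Names n} (E : Setup Γ V) where
  𝟘∈𝟙 : Γ ⊢ 𝟘 V ε 𝟙 V
  𝟘∈𝟙 = ∈-Adjoinʳ (𝟙-def E) (≐refl _)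

  𝟙∈𝟚 : Γ ⊢ 𝟙 V ε 𝟚 V
  𝟙∈𝟚 = ∈-Adjoinʳ (𝟚-def E) (≐refl _)

  𝟘∈𝟚 : Γ ⊢ 𝟘 V ε 𝟚 V
  𝟘∈𝟚 = ∈-Adjoinˡ (𝟚-def E) 𝟘∈𝟙

  𝟘∈α : Γ ⊢ 𝟘 V ε α V
  𝟘∈α = ∈-Adjoinˡ (α-def E) 𝟘∈𝟚

  𝟙∈α : Γ ⊢ 𝟙 V ε α V
  𝟙∈α = ∈-Adjoinˡ (α-def E) 𝟙∈𝟚

  A∈α : Γ ⊢ A V ε α V
  A∈α = ∈-Adjoinʳ (α-def E) (≐refl _)

  ∈𝟙 : ∀ {z} → Γ ⊢ z ε 𝟙 V → Γ ⊢ z ≐ 𝟘 V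
  ∈𝟙 = Adjoin-Empty-elim (𝟘-empty E) (𝟙-def E)

  ∈A : ∀ {z} → Γ ⊢ z ε A V → Γ ⊢ (z ≐ 𝟘 V) ∧' (x V ε y V)
  ∈A {z} m = ⇔E₁ (∀E (A-def E) z) m

  𝟘∈A : Γ ⊢ x V ε y V → Γ ⊢ 𝟘 V ε A V
  𝟘∈A m = ⇔E₂ (∀E (A-def E) _) (∧I (≐refl _) m)

  Ord-𝟚 : Γ ⊢ Ord (𝟚 V)
  Ord-𝟚 = Ord-suc (Ord-suc (Empty-Ord (𝟘-empty E)) (𝟙-def E)) (𝟚-def E)

  ⟨𝟘,𝟘⟩∈f : Γ ⊢ PairIn (f V) (𝟘 V) (𝟘 V)
  ⟨𝟘,𝟘⟩∈f = ∃∈I _ (q₁∈f E) (q₁-pair E)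

  ⟨𝟙,𝟙⟩∈f : Γ ⊢ PairIn (f V) (𝟙 V) (𝟙 V)
  ⟨𝟙,𝟙⟩∈f = ∃∈I _ (q₂∈f E) (q₂-pair E)

  ⟨A,A⟩∈f : Γ ⊢ PairIn (f V) (A V) (A V)
  ⟨A,A⟩∈f = ∃∈I _ (q₃∈f E) (q₃-pair E)

A⊆𝟙 : Setup Γ V → Γ ⊢ Sub (A V) (𝟙 V)
A⊆𝟙 E = ⊆I (ε-substˡ (≐sym (∧E₁ (∈A (E ↑) h0))) (𝟘∈𝟙 (E ↑)))

Trans-A : Setup Γ V → Γ ⊢ Trans (A V)
Trans-A E = ∀∈I (⊆I (≐-Empty-elim (𝟘-empty (E ↑ ↑)) (∧E₁ (∈A (E ↑ ↑) h1)) h0))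

Ord-α : Setup Γ V → Γ ⊢ Ord (α V)
Ord-α E = ∧I
  (∀∈I (⊆I (∨E (Adjoin-elim (α-def (E ↑ ↑)) h1)
     (∈-Adjoinˡ (α-def (E ↑ ↑ ⁺)) (Trans-∈ (∧E₁ (Ord-𝟚 (E ↑ ↑ ⁺))) h0 h1))
     (ε-substˡ (≐sym (∧E₁ (∈A (E ↑ ↑ ⁺) (ε-substʳ h0 h1)))) (𝟘∈α (E ↑ ↑ ⁺))))))
  (∀∈I (∨E (Adjoin-elim (α-def (E ↑)) h0)
     (Ord-∈-Trans (Ord-𝟚 (E ↑ ⁺)) h0)
     (≐subst (Trans v0) (≐sym h0) (Trans-A (E ↑ ⁺)))))

⊆𝟙⇒relpl-𝟙 : ∀ {z} → Setup Γ V → Γ ⊢ Sub z (𝟙 V) → Γ ⊢ relpl (𝟙 V) z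
⊆𝟙⇒relpl-𝟙 E s = cut s (∀∈I (∀∈I (⇒I
  (ε-substˡ (≐trans (∈𝟙 (E ⁺ ↑ ↑ ⁺) (⊆E h3 _ h2)) (≐sym (∈𝟙 (E ⁺ ↑ ↑ ⁺) h1))) h2))))

Graph : Names n → Fin n → Fin n → Fm n
Graph V c d = ((c ≐ 𝟘 V) ∧' (d ≐ 𝟘 V)) ∨' (((c ≐ 𝟙 V) ∧' (d ≐ 𝟙 V)) ∨' (((c ≐ A V) ∧' (d ≐ A V))
            ∨' (((c ≐ α V) ∧' (d ≐ P V)) ∨' ((c ≐ 𝟚 V) ∧' (d ≐ P V)))))

f-graph : ∀ {c d} → Setup Γ V → Γ ⊢ PairIn (f V) c d → Γ ⊢ Graph V c d
f-graph E m = ∃∈E m (∨E₅ (⇒E (∀E (f-among (E ↑ ⁺)) v0) h1)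
  (∨I₁ (Pair-≐-inj h0 h1 (q₁-pair (E ↑ ⁺ ⁺))))
  (∨I₂ (∨I₁ (Pair-≐-inj h0 h1 (q₂-pair (E ↑ ⁺ ⁺)))))
  (∨I₂ (∨I₂ (∨I₁ (Pair-≐-inj h0 h1 (q₃-pair (E ↑ ⁺ ⁺))))))
  (∨I₂ (∨I₂ (∨I₂ (∨I₁ (Pair-≐-inj h0 h1 (q₄-pair (E ↑ ⁺ ⁺)))))))
  (∨I₂ (∨I₂ (∨I₂ (∨I₂ (Pair-≐-inj h0 h1 (q₅-pair (E ↑ ⁺ ⁺))))))))

f-𝟘 : ∀ {c d} → Setup Γ V → Γ ⊢ c ≐ 𝟘 V → Γ ⊢ PairIn (f V) c d → Γ ⊢ d ≐ 𝟘 V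
f-𝟘 {Γ = Γ} {V = V} {c} {d} E c≐𝟘 p = ∨E₅ (f-graph E p)
  (∧E₂ h0)
  (≐-Empty-elim (𝟘-empty (E ⁺)) a≐𝟘 (𝟘∈𝟙 (E ⁺)))
  (≐trans (∧E₂ h0) a≐𝟘)
  (≐-Empty-elim (𝟘-empty (E ⁺)) a≐𝟘 (𝟘∈α (E ⁺)))
  (≐-Empty-elim (𝟘-empty (E ⁺)) a≐𝟘 (𝟘∈𝟚 (E ⁺)))
  where
  a≐𝟘 : ∀ {a b} → (((c ≐ a) ∧' (d ≐ b)) ∷ Γ) ⊢ a ≐ 𝟘 V
  a≐𝟘 = ≐trans (≐sym (∧E₁ h0)) (up c≐𝟘)

-- The cases c = α and c = 𝟚 are impossible: α ∉ α, and 𝟚 ∈ α forces 𝟚 = A, but 𝟙 ∈ 𝟚 while 𝟙 ∉ A.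
f-⊆𝟙 : ∀ {c d} → Setup Γ V → Γ ⊢ c ε α V → Γ ⊢ PairIn (f V) c d → Γ ⊢ Sub d (𝟙 V)
f-⊆𝟙 E c∈α p = ∨E₅ (f-graph E p)
  (≐-Empty⇒⊆ (𝟘-empty (E ⁺)) (∧E₂ h0))
  (≐⇒⊆ (∧E₂ h0))
  (⊆-trans (≐⇒⊆ (∧E₂ h0)) (A⊆𝟙 (E ⁺)))
  (¬E (ε-irrefl _) (ε-substˡ (∧E₁ h0) (up c∈α)))
  (∨E (Adjoin-elim (α-def (E ⁺)) (ε-substˡ (∧E₁ h0) (up c∈α)))
     (¬E (ε-irrefl _) h0)
     (≐-Empty-elim (𝟘-empty (E ⁺ ⁺)) (∧E₁ (∈A (E ⁺ ⁺) (ε-substʳ h0 (𝟙∈𝟚 (E ⁺ ⁺))))) (𝟘∈𝟙 (E ⁺ ⁺))))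

PlStep : Fin n → Fin n → Fin n → Fm n
PlStep f a b = All∈ a (Ex (PairIn (suc (suc f)) v1 v0)) ∧'
  All ((v0 ε suc b) ⇔' Ex∈ (suc a) (Ex (PairIn (suc (suc (suc f))) v1 v0 ∧' InPlSucc v2 v0)))

PlStep-resp : ∀ {p q a b a′ b′ f : Fin n} → Γ ⊢ p ≐ q → Γ ⊢ Pair p a b → Γ ⊢ Pair q a′ b′ →
              Γ ⊢ PlStep f a′ b′ → Γ ⊢ PlStep f a b
PlStep-resp {a = a} {b′ = b′} {f} e p q s =
  ≐subst (PlStep (suc f) (suc a) v0) (≐sym (∧E₂ (Pair-≐-inj e p q)))
    (≐subst (PlStep (suc f) v0 (suc b′)) (≐sym (∧E₁ (Pair-≐-inj e p q))) s)

PlStep-𝟘 : Setup Γ V → Γ ⊢ PlStep (f V) (𝟘 V) (𝟘 V)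
PlStep-𝟘 E = ∧I (∀∈I (Empty-elim (𝟘-empty (E ↑)) h0))
  (∀I (⇔I (Empty-elim (𝟘-empty (E ↑)) h0) (∃∈E h0 (Empty-elim (𝟘-empty (E ↑ ↑ ⁺)) h1))))

PlStep-𝟙 : Setup Γ V → Γ ⊢ PlStep (f V) (𝟙 V) (𝟙 V)
PlStep-𝟙 E = ∧I (∀∈I (PairIn-≐⇒∃ (⟨𝟘,𝟘⟩∈f (E ↑)) (∈𝟙 (E ↑) h0)))
  (∀I (⇔I
     (∃∈I _ (𝟘∈𝟙 (E ↑)) (∃I _ (∧I (⟨𝟘,𝟘⟩∈f (E ↑)) (∧I (≐⇒⊆ (∈𝟙 (E ↑) h0)) (relpl-Empty (𝟘-empty (E ↑)))))))
     (∃∈E h0 (∃E h0 (∈-Adjoinʳ (𝟙-def (E ↑ ↑ ⁺ ↑))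
        (⊆-Empty (𝟘-empty (E ↑ ↑ ⁺ ↑)) (⊆-trans (∧E₁ (∧E₂ h0))
           (≐⇒⊆ (f-𝟘 (E ↑ ↑ ⁺ ↑) (∈𝟙 (E ↑ ↑ ⁺ ↑) h2) (∧E₁ h0))))))))))

PlStep-A : Setup Γ V → Γ ⊢ PlStep (f V) (A V) (A V)
PlStep-A E = ∧I (∀∈I (PairIn-≐⇒∃ (⟨𝟘,𝟘⟩∈f (E ↑)) (∧E₁ (∈A (E ↑) h0))))
  (∀I (⇔I
     (∃∈I _ (𝟘∈A (E ↑) (∧E₂ (∈A (E ↑) h0)))
        (∃I _ (∧I (⟨𝟘,𝟘⟩∈f (E ↑)) (∧I (≐⇒⊆ (∧E₁ (∈A (E ↑) h0))) (relpl-Empty (𝟘-empty (E ↑)))))))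
     (∃∈E h0 (∃E h0 (⇔E₂ (∀E (A-def (E ↑ ↑ ⁺ ↑)) v2)
        (∧I (⊆-Empty (𝟘-empty (E ↑ ↑ ⁺ ↑)) (⊆-trans (∧E₁ (∧E₂ h0))
               (≐⇒⊆ (f-𝟘 (E ↑ ↑ ⁺ ↑) (∧E₁ (∈A (E ↑ ↑ ⁺ ↑) h2)) (∧E₁ h0)))))
            (∧E₂ (∈A (E ↑ ↑ ⁺ ↑) h2))))))))

PlStep-α : Setup Γ V → Γ ⊢ PlStep (f V) (α V) (P V)
PlStep-α E = ∧I
  (∀∈I (∨E (Adjoin-elim (α-def (E ↑)) h0)
          (∨E (Adjoin-elim (𝟚-def (E ↑ ⁺)) h0)
             (PairIn-≐⇒∃ (⟨𝟘,𝟘⟩∈f (E ↑ ⁺ ⁺)) (∈𝟙 (E ↑ ⁺ ⁺) h0))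
             (PairIn-≐⇒∃ (⟨𝟙,𝟙⟩∈f (E ↑ ⁺ ⁺)) h0))
          (PairIn-≐⇒∃ (⟨A,A⟩∈f (E ↑ ⁺)) h0)))
  (∀I (⇔I
     (∃∈I _ (𝟙∈α (E ↑)) (∃I _ (∧I (⟨𝟙,𝟙⟩∈f (E ↑))
        (∧I (⇔E₁ (∀E (P-def (E ↑)) v0) h0) (⊆𝟙⇒relpl-𝟙 (E ↑) (⇔E₁ (∀E (P-def (E ↑)) v0) h0))))))
     (∃∈E h0 (∃E h0 (⇔E₂ (∀E (P-def (E ↑ ↑ ⁺ ↑)) v2)
        (⊆-trans (∧E₁ (∧E₂ h0)) (f-⊆𝟙 (E ↑ ↑ ⁺ ↑) h2 (∧E₁ h0))))))))

PlStep-𝟚 : Setup Γ V → Γ ⊢ PlStep (f V) (𝟚 V) (P V)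
PlStep-𝟚 E = ∧I
  (∀∈I (∨E (Adjoin-elim (𝟚-def (E ↑)) h0)
          (PairIn-≐⇒∃ (⟨𝟘,𝟘⟩∈f (E ↑ ⁺)) (∈𝟙 (E ↑ ⁺) h0))
          (PairIn-≐⇒∃ (⟨𝟙,𝟙⟩∈f (E ↑ ⁺)) h0)))
  (∀I (⇔I
     (∃∈I _ (𝟙∈𝟚 (E ↑)) (∃I _ (∧I (⟨𝟙,𝟙⟩∈f (E ↑))
        (∧I (⇔E₁ (∀E (P-def (E ↑)) v0) h0) (⊆𝟙⇒relpl-𝟙 (E ↑) (⇔E₁ (∀E (P-def (E ↑)) v0) h0))))))
     (∃∈E h0 (∃E h0 (⇔E₂ (∀E (P-def (E ↑ ↑ ⁺ ↑)) v2)
        (⊆-trans (∧E₁ (∧E₂ h0)) (f-⊆𝟙 (E ↑ ↑ ⁺ ↑) (∈-Adjoinˡ (α-def (E ↑ ↑ ⁺ ↑)) h2) (∧E₁ h0))))))))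

f-PlAttempt : Setup Γ V → Γ ⊢ PlAttempt (f V)
f-PlAttempt E = ∀∈I (∀I (∀I (⇒I
  (∨E₅ (⇒E (∀E (f-among (E ↑ ʷ ʷ ⁺)) v2) h1)
    (PlStep-resp h0 h1 (q₁-pair (E ↑ ʷ ʷ ⁺ ⁺)) (PlStep-𝟘 (E ↑ ʷ ʷ ⁺ ⁺)))
    (PlStep-resp h0 h1 (q₂-pair (E ↑ ʷ ʷ ⁺ ⁺)) (PlStep-𝟙 (E ↑ ʷ ʷ ⁺ ⁺)))
    (PlStep-resp h0 h1 (q₃-pair (E ↑ ʷ ʷ ⁺ ⁺)) (PlStep-A (E ↑ ʷ ʷ ⁺ ⁺)))
    (PlStep-resp h0 h1 (q₄-pair (E ↑ ʷ ʷ ⁺ ⁺)) (PlStep-α (E ↑ ʷ ʷ ⁺ ⁺)))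
    (PlStep-resp h0 h1 (q₅-pair (E ↑ ʷ ʷ ⁺ ⁺)) (PlStep-𝟚 (E ↑ ʷ ʷ ⁺ ⁺)))))))

Cond1′ : Fm n
Cond1′ = PlUb ∧' All (All (All ((Ord v2 ∧' Ord v1 ∧' PlG v2 v0 ∧' PlG v1 v0) ⇒' (v2 ≐ v1))))

α≐𝟚 : Setup Γ V → Γ ⊢ Cond1′ → Γ ⊢ α V ≐ 𝟚 V
α≐𝟚 {V = V} E c = ⇒E (∀E (∀E (∀E (∧E₂ c) (α V)) (𝟚 V)) (P V))
  (∧I (Ord-α E) (∧I (Ord-𝟚 E) (∧I (∃I (f V) (∧I (f-PlAttempt E) (∃∈I (q₄ V) (q₄∈f E) (q₄-pair E))))
                                  (∃I (f V) (∧I (f-PlAttempt E) (∃∈I (q₅ V) (q₅∈f E) (q₅-pair E)))))))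

-- A ∈ α = 𝟚 = {𝟘, 𝟙}: A = 𝟙 gives 𝟘 ∈ A, i.e. x ∈ y, and A = 𝟘 refutes x ∈ y.
Setup⇒ε-decidable : Setup Γ V → Γ ⊢ Cond1′ → Γ ⊢ (x V ε y V) ∨' ¬' (x V ε y V)
Setup⇒ε-decidable E c = ∨E (Adjoin-elim (𝟚-def E) (ε-substʳ (α≐𝟚 E c) (A∈α E)))
  (∨I₂ (⇒I (≐-Empty-elim (𝟘-empty (E ⁺ ⁺)) (∈𝟙 (E ⁺ ⁺) h1) (𝟘∈A (E ⁺ ⁺) h0))))
  (∨I₁ (∧E₂ (∈A (E ⁺) (ε-substʳ (≐sym h0) (𝟘∈𝟙 (E ⁺))))))

var : (k : ℕ) → Fin (k + suc n)
var k = k ↑ʳ zero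

Cond1′⇒ε-decidable : (a b : Fin n) → Γ ⊢ Cond1′ → Γ ⊢ (a ε b) ∨' ¬' (a ε b)
Cond1′⇒ε-decidable a b c = cut c
  (∃E (ax emptySet)
  (∃E (Adjoin-∃ v0 v0)
  (∃E (Adjoin-∃ v0 v0)
  (∃E (TruthValue-∃ (suc (suc (suc a))) (suc (suc (suc b))) h1)
  (∃E (Adjoin-∃ v1 v0)
  (∃E (PlUb⇒PowerSet-singleton-∅ h4 h3 (∧E₁ h5))
  (∃E (Pair-∃ v5 v5)
  (∃E (Pair-∃ v5 v5)
  (∃E (Pair-∃ v4 v4)
  (∃E (Pair-∃ v4 v3)
  (∃E (Pair-∃ v7 v4)
  (∃E (FiveSet-∃ v4 v3 v2 v1 v0 h10)
  (Setup⇒ε-decidable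
    {V = record { x = 12 ↑ʳ a ; y = 12 ↑ʳ b ; 𝟘 = var 11 ; 𝟙 = var 10 ; 𝟚 = var 9 ; A = var 8 ; α = v7 ; P = v6
                ; q₁ = v5 ; q₂ = v4 ; q₃ = v3 ; q₄ = v2 ; q₅ = v1 ; f = v0 }}
    (record { 𝟘-empty = h11 ; 𝟙-def = h10 ; 𝟚-def = h9 ; A-def = h8 ; α-def = h7 ; P-def = h6
            ; q₁-pair = h5 ; q₂-pair = h4 ; q₃-pair = h3 ; q₄-pair = h2 ; q₅-pair = h1 ; f-among = ∧E₁ h0
            ; q₁∈f = ∧E₁ (∧E₂ h0) ; q₂∈f = ∧E₁ (∧E₂ (∧E₂ h0)) ; q₃∈f = ∧E₁ (∧E₂ (∧E₂ (∧E₂ h0)))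
            ; q₄∈f = ∧E₁ (∧E₂ (∧E₂ (∧E₂ (∧E₂ h0)))) ; q₅∈f = ∧E₂ (∧E₂ (∧E₂ (∧E₂ (∧E₂ h0)))) })
    h12)))))))))))))

Cond1⇒REM : (Cond1 ∷ []) ⊢ REM
Cond1⇒REM = ∀I (∀I (Cond1′⇒ε-decidable v1 v0 (⊢-wk (⊢-wk h0))))

proposition3p3 : IKP⊢ (Cond1 ⇔' REM)
proposition3p3 = ⇔I Cond1⇒REM REM⇒Cond1
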